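{- Let $G$ be a finite directed graph. The sets declared as strong components by Algorithm C (described in the context) are exactly the strong components of $G$.
   Context: Loops and parallel arcs are allowed; each arc goes from its tail to its tip. Two vertices are mutually reachable if each is reachable from the other by a directed path; the equivalence classes are the strong components. A depth-first exploration proceeds as follows. Initially all vertices are unvisited, all arcs untraversed, and the current vertex is null. Repeat the applicable case until all vertices are visited and all arcs are traversed: (i) The current vertex is null and some vertex is unvisited: choose any unvisited vertex $v$, make it current and visit it; $v$ is the root of a new search. (ii) The current vertex $v$ has an untraversed exiting arc: choose any such arc $a$, from $v$ to $w$, and advance on it. If $w$ is already visited, immediately retreat on $a$; in this case $a$ is a non-tree arc and this advance–retreat pair is its traversal. Otherwise $a$ becomes a tree arc, $w$ becomes current, and $w$ is visited. (iii) The current vertex $v$ has no untraversed exiting arc: if $v$ is the root of the current search, the current vertex becomes null; otherwise retreat on the tree arc entering $v$, say from $u$, and make $u$ current. The visit of $v$ is its previsit. The step (iii) at which $v$ is current with no untraversed exiting arc is its postvisit. Algorithm C performs one depth-first exploration while maintaining a collection of disjoint vertex sets, each with a designated leader, and a stack $L$ of leaders (initially empty). - Previsit of $v$: set $v.\mathit{pre}$ to the next integer $1,2,\dots$; create the set $\{v\}$ with leader $v$; push $v$ onto $L$. - Traversal of a non-tree arc with tip $y$: while the top vertex of $L$ has $\mathit{pre}$ value greater than $y.\mathit{pre}$, pop the top vertex of $L$ and unite its set with the set of the new top vertex of $L$; that new top vertex becomes the leader of the united set. - Postvisit of $v$: if $v$ is on top of $L$, pop $v$ from $L$, set $w.\mathit{pre}\gets\infty$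 for every vertex $w$ in the set with leader $v$, and declare this set a strong component. Here $\infty$ exceeds every integer. -}

module Defs where

open import Data.Nat using (ℕ; zero; suc; _<ᵇ_)
open import Data.Fin using (Fin)
open import Data.Fin.Properties using (_≟_)
open import Data.Fin.Subset using (Subset; _∈_)
open import Data.Vec using (tabulate)
open import Data.Bool using (Bool; true; false; if_then_else_; _∧_; not)
open import Data.List using (List; []; _∷_)
open import Data.Maybe using (Maybe; just; nothing)
open import Data.Product using (_×_; _,_; ∃; ∃-syntax)
open import Relation.Nullary using (does; ¬_)
open import Relation.Binary.PropositionalEquality using (_≡_; _≢_)
open import Relation.Binary.Construct.Closure.ReflexiveTransitive using (Star)
open import Function.Bundles using (_⇔_)

record Digraph : Set where
  field
    n    : ℕ
    m    : ℕ
    tail : Fin m → Fin n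
    tip  : Fin m → Fin n

data Pre : Set where
  unv : Pre
  num : ℕ → Pre
  inf : Pre

_>ᵖ_ : Pre → Pre → Bool
num a >ᵖ num b = b <ᵇ a
inf   >ᵖ num _ = true
_     >ᵖ _     = false

module _ (G : Digraph) where
  open Digraph G

  ArcRel : Fin n → Fin n → Set
  ArcRel u v = ∃[ a ] (tail a ≡ u × tip a ≡ v)

  Reachable : Fin n → Fin n → Set
  Reachable = Star ArcRel

  MutuallyReachable : Fin n → Fin n → Set
  MutuallyReachable u v = Reachable u v × Reachable v u

  IsStrongComponent : Subset n → Set
  IsStrongComponent S = ∃[ v ] (∀ w → (w ∈ S) ⇔ MutuallyReachable v w)

  -- State of the depth-first exploration together with Algorithm C.
  --  pre    : pre value (unv = unvisited)
  --  next   : next integer to be assigned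
  --  trav   : which arcs have been traversed
  --  search : nothing = current vertex null; just (r , p) = current
  --           search has root r and p is the list of tree arcs on the
  --           path from r to the current vertex (most recent first)
  --  ldr    : ldr w is the leader of the set containing w (visited w)
  --  L      : stack of leaders (head = top)
  --  out    : sets declared as strong components so far
  record State : Set where
    field
      pre    : Fin n → Pre
      next   : ℕ
      trav   : Fin m → Bool
      search : Maybe (Fin n × List (Fin m))
      ldr    : Fin n → Fin n
      L      : List (Fin n)
      out    : List (Subset n)
  open State public

  initial : State
  initial = record
    { pre = λ _ → unv ; next = 1 ; trav = λ _ → false ; search = nothing
    ; ldr = λ w → w ; L = [] ; out = [] }

  visited : State → Fin n → Set
  visited s v = pre s v ≢ unv

  isUnv : Pre → Bool
  isUnv unv = true
  isUnv _   = false

  current : Fin n × List (Fin m) → Fin n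
  current (r , [])    = r
  current (r , a ∷ _) = tip a

  updArc : (Fin m → Bool) → Fin m → (Fin m → Bool)
  updArc f a b = if does (b ≟ a) then true else f b

  previsit : Fin n → State → State
  previsit v s = record s
    { pre  = λ w → if does (w ≟ v) then num (next s) else pre s w
    ; next = suc (next s)
    ; ldr  = λ w → if does (w ≟ v) then v else ldr s w
    ; L    = v ∷ L s }

  unite : Fin n → Fin n → (Fin n → Fin n) → (Fin n → Fin n)
  unite x z ld w = if does (ld w ≟ x) then z else ld w

  -- the while-loop executed on traversal of a non-tree arc with tip y
  -- (py = y.pre)
  popLoop : (Fin n → Pre) → Pre → List (Fin n) → (Fin n → Fin n)
          → List (Fin n) × (Fin n → Fin n)
  popLoop pr py (x ∷ z ∷ rest) ld =
    if pr x >ᵖ py then popLoop pr py (z ∷ rest) (unite x z ld)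
                  else (x ∷ z ∷ rest , ld)
  popLoop pr py l ld = (l , ld)

  nonTree : Fin n → State → State
  nonTree y s with popLoop (pre s) (pre s y) (L s) (ldr s)
  ... | (L' , ld') = record s { L = L' ; ldr = ld' }

  setOf : State → Fin n → Subset n
  setOf s v = tabulate (λ w → not (isUnv (pre s w)) ∧ does (ldr s w ≟ v))

  postvisit : Fin n → State → State
  postvisit v s with L s
  ... | [] = s
  ... | x ∷ rest with does (x ≟ v)
  ...   | false = s
  ...   | true  = record s
          { L   = rest
          ; pre = λ w → if not (isUnv (pre s w)) ∧ does (ldr s w ≟ v)
                          then inf else pre s w
          ; out = setOf s v ∷ out s }

  markArc : Fin m → State → State
  markArc a s = record s { trav = updArc (trav s) a }

  setSearch : Maybe (Fin n × List (Fin m)) → State → State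
  setSearch sr s = record s { search = sr }

  retreat : Fin n × List (Fin m) → Maybe (Fin n × List (Fin m))
  retreat (r , [])    = nothing
  retreat (r , _ ∷ p) = just (r , p)

  -- one step of the exploration (cases (i), (ii), (iii)); all choices
  -- are nondeterministic
  data Step : State → State → Set where
    newRoot  : ∀ {s} v → search s ≡ nothing → pre s v ≡ unv →
               Step s (previsit v (setSearch (just (v , [])) s))
    treeArc  : ∀ {s r p} a → search s ≡ just (r , p) →
               tail a ≡ current (r , p) → trav s a ≡ false →
               pre s (tip a) ≡ unv →
               Step s (previsit (tip a)
                        (setSearch (just (r , a ∷ p)) (markArc a s)))
    nonTreeArc : ∀ {s r p} a → search s ≡ just (r , p) →
               tail a ≡ current (r , p) → trav s a ≡ false →
               pre s (tip a) ≢ unv →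
               Step s (nonTree (tip a) (markArc a s))
    finish   : ∀ {s r p} → search s ≡ just (r , p) →
               (∀ a → tail a ≡ current (r , p) → trav s a ≡ true) →
               Step s (setSearch (retreat (r , p))
                        (postvisit (current (r , p)) s))

  -- no case applies: current vertex null and every vertex visited
  Terminal : State → Set
  Terminal s = search s ≡ nothing × (∀ v → visited s v)

{-# OPTIONS --safe #-}
-- During a search whose tree path P starts at
-- the root, the stack L consists of vertices of P with pre values decreasing from the top; the
-- leader of a numbered vertex y is the topmost entry of L whose pre value does not exceed that
-- of y, and y and its leader are mutually reachable; a traversed arc has a finished (pre = ∞)
-- endpoint, joins two vertices of one set, or is a tree arc of P.  Finished vertices are closed
-- under arcs and lie in declared sets, which are strong components.  At the postvisit of a leader
-- v on top of L every arc out of the set of v stays in the set or ends in a finished vertex, and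
-- no finished vertex reaches v, so that set is exactly the strong component of v.  In a terminal
-- state every vertex is finished, hence in a declared set, which gives the converse.

module Submission where

open import Defs
open import Data.Bool using (Bool; true; false; if_then_else_; _∧_; not)
open import Data.Bool.Properties using (T-≡)
open import Data.Empty using (⊥; ⊥-elim)
open import Data.Fin using (Fin)
open import Data.Fin.Properties using (_≟_)
open import Data.Fin.Subset using (Subset; _∈_)
open import Data.Fin.Subset.Properties using (⊆-antisym)
open import Data.List using (List; []; _∷_; _++_)
open import Data.List.Membership.Propositional using (find) renaming (_∈_ to _∈ₗ_; _∉_ to _∉ₗ_)
open import Data.List.Membership.Propositional.Properties using (∈-++⁺ˡ; ∈-++⁺ʳ)
open import Data.List.Relation.Unary.All as All using (All; []; _∷_)
open import Data.List.Relation.Unary.All.Properties using (++⁻ʳ)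
open import Data.List.Relation.Unary.AllPairs using (AllPairs; []; _∷_)
open import Data.List.Relation.Unary.Any using (here; there)
open import Data.List.Relation.Unary.First as First using (First; [_]; _∷_; toAny)
open import Data.Maybe using (Maybe; just; nothing)
open import Data.Nat using (_<_)
open import Data.Nat.Properties using (n<1+n; m<n⇒m<1+n; <ᵇ⇒<; <⇒<ᵇ; <-trans; ≤-<-trans; <-irrefl; ≮⇒≥)
open import Data.Product using (_×_; _,_; proj₁; proj₂; ∃-syntax)
open import Data.Sum using (_⊎_; inj₁; inj₂)
open import Data.Unit using (⊤; tt)
open import Data.Vec.Properties using (lookup∘tabulate; []=⇒lookup; lookup⇒[]=)
open import Function.Bundles using (_⇔_; mk⇔; Equivalence)
open import Relation.Binary.Construct.Closure.ReflexiveTransitive using (Star; ε; _◅_; _◅◅_)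
open import Relation.Binary.PropositionalEquality using (_≡_; _≢_; refl; sym; trans; cong; subst; subst₂)
open import Relation.Nullary using (Dec; yes; no; does; ¬_)
open import Relation.Nullary.Decidable using (dec-true; dec-false)

infix 4 _≻_

data _≻_ : Pre → Pre → Set where
  num≻num : ∀ {a b} → b < a → num a ≻ num b
  inf≻num : ∀ {b} → inf ≻ num b

>ᵖ-sound : ∀ {p q} → p >ᵖ q ≡ true → p ≻ q
>ᵖ-sound {num a} {num b} e = num≻num (<ᵇ⇒< b a (Equivalence.from T-≡ e))
>ᵖ-sound {inf}   {num b} _ = inf≻num

>ᵖ-complete : ∀ {p q} → p ≻ q → p >ᵖ q ≡ true
>ᵖ-complete (num≻num b<a) = Equivalence.to T-≡ (<⇒<ᵇ b<a)
>ᵖ-complete inf≻num       = refl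

>ᵖ-false : ∀ {p q} → ¬ p ≻ q → p >ᵖ q ≡ false
>ᵖ-false {p} {q} p⊁q with p >ᵖ q in e
... | true  = ⊥-elim (p⊁q (>ᵖ-sound e))
... | false = refl

Numbered : Pre → Set
Numbered q = ∃[ k ] q ≡ num k

Numbered⇒≢unv : ∀ {q} → Numbered q → q ≢ unv
Numbered⇒≢unv (_ , refl) ()

Numbered⇒≢inf : ∀ {q} → Numbered q → q ≢ inf
Numbered⇒≢inf (_ , refl) ()

Pre-cases : ∀ q → q ≡ unv ⊎ Numbered q ⊎ q ≡ inf
Pre-cases unv     = inj₁ refl
Pre-cases (num k) = inj₂ (inj₁ (k , refl))
Pre-cases inf     = inj₂ (inj₂ refl)

≻-irrefl : ∀ {p} → ¬ p ≻ p
≻-irrefl (num≻num a<a) = <-irrefl refl a<a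

≻-trans : ∀ {p q r} → p ≻ q → q ≻ r → p ≻ r
≻-trans (num≻num b<a) (num≻num c<b) = num≻num (<-trans c<b b<a)
≻-trans inf≻num       (num≻num _)   = inf≻num

≻-⊁-⊁ : ∀ {x y l} → x ≻ y → ¬ l ≻ y → ¬ l ≻ x
≻-⊁-⊁ x≻y l⊁y l≻x = l⊁y (≻-trans l≻x x≻y)

⊁-≻-≻ : ∀ {x y l} → Numbered x → ¬ x ≻ y → l ≻ y → l ≻ x
⊁-≻-≻ (a , refl) x⊁y (num≻num c<d) = num≻num (≤-<-trans (≮⇒≥ (λ c<a → x⊁y (num≻num c<a))) c<d)
⊁-≻-≻ (a , refl) x⊁y inf≻num       = inf≻num

module _ {A : Set} where

  Sorted : (A → Pre) → List A → Set
  Sorted pr = AllPairs (λ x y → pr x ≻ pr y)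

  sorted-++⁻ʳ : ∀ pr xs {ys} → Sorted pr (xs ++ ys) → Sorted pr ys
  sorted-++⁻ʳ pr []       s       = s
  sorted-++⁻ʳ pr (x ∷ xs) (_ ∷ s) = sorted-++⁻ʳ pr xs s

  sorted-disjoint : ∀ pr xs {ys x} → Sorted pr (xs ++ ys) → x ∈ₗ xs → x ∉ₗ ys
  sorted-disjoint pr (y ∷ xs) (above ∷ _) (here refl) x∈ys = ≻-irrefl (All.lookup above (∈-++⁺ʳ xs x∈ys))
  sorted-disjoint pr (y ∷ xs) (_ ∷ s)     (there x∈)  x∈ys = sorted-disjoint pr xs s x∈ x∈ys

  sorted-cong : ∀ pr pr′ {xs} → (∀ {x} → x ∈ₗ xs → pr′ x ≡ pr x) → Sorted pr xs → Sorted pr′ xs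
  sorted-cong pr pr′ eq []             = []
  sorted-cong pr pr′ eq (above ∷ s) =
    All.tabulate (λ y∈ → subst₂ _≻_ (sym (eq (here refl))) (sym (eq (there y∈))) (All.lookup above y∈)) ∷
    sorted-cong pr pr′ (λ x∈ → eq (there x∈)) s

  First-mapUnder : ∀ {P Q P′ Q′ R : A → Set} {xs} → All R xs →
                   (∀ {x} → R x → P x → P′ x) → (∀ {x} → R x → Q x → Q′ x) →
                   First P Q xs → First P′ Q′ xs
  First-mapUnder (r ∷ _)  f g [ q ]    = [ g r q ]
  First-mapUnder (r ∷ rs) f g (p ∷ fs) = f r p ∷ First-mapUnder rs f g fs

  First-++⁻ʳ : ∀ {P Q : A → Set} xs {ys} → First P Q (xs ++ ys) →
               (∀ {x} → Q x → x ∉ₗ xs) → First P Q ys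
  First-++⁻ʳ []       f        noQ = f
  First-++⁻ʳ (x ∷ xs) [ q ]    noQ = ⊥-elim (noQ q (here refl))
  First-++⁻ʳ (x ∷ xs) (_ ∷ f)  noQ = First-++⁻ʳ xs f (λ q x∈ → noQ q (there x∈))

  head-++ : ∀ {z : A} {zs} xs y ys → z ∷ zs ≡ xs ++ y ∷ ys → z ∈ₗ xs ⊎ (xs ≡ [] × z ≡ y)
  head-++ []       y ys refl = inj₂ (refl , refl)
  head-++ (x ∷ xs) y ys refl = inj₁ (here refl)

  no-member⇒[] : ∀ {xs : List A} → (∀ {x} → x ∉ₗ xs) → xs ≡ []
  no-member⇒[] {[]}    _   = refl
  no-member⇒[] {x ∷ _} ∉xs = ⊥-elim (∉xs (here refl))

module _ (G : Digraph) where
  open Digraph G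
  open import Data.List.Membership.DecPropositional (_≟_ {n}) using (_∈?_)

  OnPath : Fin n → List (Fin m) → Fin n → Set
  OnPath r []      v = v ≡ r
  OnPath r (a ∷ p) v = v ≡ tip a ⊎ OnPath r p v

  IsTreePath : Fin n → List (Fin m) → Set
  IsTreePath r []      = ⊤
  IsTreePath r (a ∷ p) = tail a ≡ current G (r , p) × IsTreePath r p

  PreIncreasing : (Fin n → Pre) → Fin n → List (Fin m) → Set
  PreIncreasing pr r []      = Numbered (pr r)
  PreIncreasing pr r (a ∷ p) =
    Numbered (pr (tip a)) × (∀ u → OnPath r p u → pr (tip a) ≻ pr u) × PreIncreasing pr r p

  onPath-current : ∀ r p → OnPath r p (current G (r , p))
  onPath-current r []      = refl
  onPath-current r (a ∷ p) = inj₁ refl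

  onPath-reaches-current : ∀ r p → IsTreePath r p → ∀ u → OnPath r p u →
                           Reachable G u (current G (r , p))
  onPath-reaches-current r []      _        u refl       = ε
  onPath-reaches-current r (a ∷ p) _        u (inj₁ refl) = ε
  onPath-reaches-current r (a ∷ p) (ta , t) u (inj₂ o)    =
    onPath-reaches-current r p t u o ◅◅ ((a , ta , refl) ◅ ε)

  onPath-Numbered : ∀ pr r p → PreIncreasing pr r p → ∀ u → OnPath r p u → Numbered (pr u)
  onPath-Numbered pr r []      num₀          u refl        = num₀
  onPath-Numbered pr r (a ∷ p) (num₀ , _ , _) u (inj₁ refl) = num₀
  onPath-Numbered pr r (a ∷ p) (_ , _ , inc) u (inj₂ o)    = onPath-Numbered pr r p inc u o

  onPath-current⊎≺ : ∀ pr r p → PreIncreasing pr r p → ∀ u → OnPath r p u →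
                     u ≡ current G (r , p) ⊎ pr (current G (r , p)) ≻ pr u
  onPath-current⊎≺ pr r []      _               u e        = inj₁ e
  onPath-current⊎≺ pr r (a ∷ p) _               u (inj₁ e) = inj₁ e
  onPath-current⊎≺ pr r (a ∷ p) (_ , above , _) u (inj₂ o) = inj₂ (above u o)

  onPath-⊁-current : ∀ pr r p → PreIncreasing pr r p → ∀ u → OnPath r p u →
                     ¬ pr u ≻ pr (current G (r , p))
  onPath-⊁-current pr r []      _             u refl        = ≻-irrefl
  onPath-⊁-current pr r (a ∷ p) _             u (inj₁ refl) = ≻-irrefl
  onPath-⊁-current pr r (a ∷ p) (_ , above , _) u (inj₂ o) u≻c = ≻-irrefl (≻-trans u≻c (above u o))

  preIncreasing-cong : ∀ pr pr′ r p → (∀ u → OnPath r p u → pr′ u ≡ pr u) →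
                       PreIncreasing pr r p → PreIncreasing pr′ r p
  preIncreasing-cong pr pr′ r []      eq num₀ = subst Numbered (sym (eq r refl)) num₀
  preIncreasing-cong pr pr′ r (a ∷ p) eq (num₀ , above , inc) =
    subst Numbered (sym eqᵗ) num₀ ,
    (λ u o → subst₂ _≻_ (sym eqᵗ) (sym (eq u (inj₂ o))) (above u o)) ,
    preIncreasing-cong pr pr′ r p (λ u o → eq u (inj₂ o)) inc
    where
    eqᵗ : pr′ (tip a) ≡ pr (tip a)
    eqᵗ = eq (tip a) (inj₁ refl)

  onPath-⊁-reaches : ∀ pr r p → IsTreePath r p → PreIncreasing pr r p → ∀ u x →
                     OnPath r p u → OnPath r p x → ¬ pr u ≻ pr x → Reachable G u x
  onPath-⊁-reaches pr r []      _ _ u x refl refl _ = ε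
  onPath-⊁-reaches pr r (a ∷ p) t _ u x ou (inj₁ refl) _ = onPath-reaches-current r (a ∷ p) t u ou
  onPath-⊁-reaches pr r (a ∷ p) _ (_ , above , _) u x (inj₁ refl) (inj₂ ox) u⊁x =
    ⊥-elim (u⊁x (above x ox))
  onPath-⊁-reaches pr r (a ∷ p) (_ , t) (_ , _ , inc) u x (inj₂ ou) (inj₂ ox) u⊁x =
    onPath-⊁-reaches pr r p t inc u x ou ox u⊁x

  tail-onPath : ∀ r b p a → IsTreePath r (b ∷ p) → a ∈ₗ (b ∷ p) → OnPath r p (tail a)
  tail-onPath r b p       a (tb , _) (here refl) = subst (OnPath r p) (sym tb) (onPath-current r p)
  tail-onPath r b (c ∷ p) a (_ , t)  (there a∈) = inj₂ (tail-onPath r c p a t a∈)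

  current-≻-tail : ∀ pr r p a → IsTreePath r p → PreIncreasing pr r p → a ∈ₗ p →
                   pr (current G (r , p)) ≻ pr (tail a)
  current-≻-tail pr r (b ∷ p) a t (_ , above , _) a∈ = above (tail a) (tail-onPath r b p a t a∈)

  strongComponent-unique : ∀ {S S′} v → IsStrongComponent G S → IsStrongComponent G S′ →
                           v ∈ S → v ∈ S′ → S ≡ S′
  strongComponent-unique v (u , S≈) (u′ , S′≈) v∈S v∈S′ = ⊆-antisym (S⊆S′ S≈ S′≈ v∈S v∈S′) (S⊆S′ S′≈ S≈ v∈S′ v∈S)
    where
    S⊆S′ : ∀ {S S′ u u′} → (∀ w → (w ∈ S) ⇔ MutuallyReachable G u w) →
           (∀ w → (w ∈ S′) ⇔ MutuallyReachable G u′ w) → v ∈ S → v ∈ S′ → ∀ {w} → w ∈ S → w ∈ S′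
    S⊆S′ S≈ S′≈ v∈S v∈S′ {w} w∈S with Equivalence.to (S≈ v) v∈S | Equivalence.to (S′≈ v) v∈S′ | Equivalence.to (S≈ w) w∈S
    ... | u↝v , v↝u | u′↝v , v↝u′ | u↝w , w↝u = Equivalence.from (S′≈ w) (u′↝v ◅◅ v↝u ◅◅ u↝w , w↝u ◅◅ u↝v ◅◅ v↝u′)

  unite-hit : ∀ x z ld w → ld w ≡ x → unite G x z ld w ≡ z
  unite-hit x z ld w e rewrite dec-true (ld w ≟ x) e = refl

  unite-miss : ∀ x z ld w → ld w ≢ x → unite G x z ld w ≡ ld w
  unite-miss x z ld w ne rewrite dec-false (ld w ≟ x) ne = refl

  popLoop-stop : ∀ pr py x z rest ld → ¬ pr x ≻ py →
                 popLoop G pr py (x ∷ z ∷ rest) ld ≡ (x ∷ z ∷ rest , ld)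
  popLoop-stop pr py x z rest ld x⊁y rewrite >ᵖ-false x⊁y = refl

  popLoop-pop : ∀ pr py x z rest ld → pr x ≻ py →
                popLoop G pr py (x ∷ z ∷ rest) ld ≡ popLoop G pr py (z ∷ rest) (unite G x z ld)
  popLoop-pop pr py x z rest ld x≻y rewrite >ᵖ-complete x≻y = refl

  popLoop-inert : ∀ pr py xs ld → (∀ x → ¬ pr x ≻ py) → popLoop G pr py xs ld ≡ (xs , ld)
  popLoop-inert pr py []            ld _   = refl
  popLoop-inert pr py (x ∷ [])      ld _   = refl
  popLoop-inert pr py (x ∷ z ∷ rest) ld ⊁py = popLoop-stop pr py x z rest ld (⊁py x)

  record PopOutcome (pr : Fin n → Pre) (py : Pre) (Q : Fin n → Set)
                    (xs : List (Fin n)) (ld : Fin n → Fin n) : Set where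
    field
      popped    : List (Fin n)
      survivor  : Fin n
      below     : List (Fin n)
      split     : xs ≡ popped ++ survivor ∷ below
      popped-≻  : All (λ x → pr x ≻ py) popped
      survivor-Q : Q survivor
      stack     : proj₁ (popLoop G pr py xs ld) ≡ survivor ∷ below
      merged    : ∀ w → ld w ∈ₗ popped → proj₂ (popLoop G pr py xs ld) w ≡ survivor
      unmerged  : ∀ w → ld w ∉ₗ popped → proj₂ (popLoop G pr py xs ld) w ≡ ld w

  popLoop-outcome : ∀ pr py {Q : Fin n → Set} → (∀ {x} → Q x → ¬ pr x ≻ py) →
                    ∀ xs ld → First (λ x → pr x ≻ py) Q xs → PopOutcome pr py Q xs ld
  popLoop-outcome pr py Q⇒⊁ (x ∷ []) ld [ q ] =
    record { popped = [] ; survivor = x ; below = [] ; split = refl ; popped-≻ = [] ; survivor-Q = q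
           ; stack = refl ; merged = λ _ () ; unmerged = λ _ _ → refl }
  popLoop-outcome pr py Q⇒⊁ (x ∷ z ∷ rest) ld [ q ] =
    record { popped = [] ; survivor = x ; below = z ∷ rest ; split = refl ; popped-≻ = [] ; survivor-Q = q
           ; stack = cong proj₁ stop ; merged = λ _ () ; unmerged = λ w _ → cong (λ o → proj₂ o w) stop }
    where
    stop : popLoop G pr py (x ∷ z ∷ rest) ld ≡ (x ∷ z ∷ rest , ld)
    stop = popLoop-stop pr py x z rest ld (Q⇒⊁ q)
  popLoop-outcome pr py Q⇒⊁ (x ∷ z ∷ rest) ld (x≻y ∷ f) =
    record { popped = x ∷ popped ; survivor = survivor ; below = below ; split = cong (x ∷_) split
           ; popped-≻ = x≻y ∷ popped-≻ ; survivor-Q = survivor-Q ; stack = trans (cong proj₁ pop) stack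
           ; merged = λ w lw∈ → trans (at w) (merged′ w lw∈)
           ; unmerged = λ w lw∉ → trans (at w) (unmerged′ w lw∉) }
    where
    open PopOutcome (popLoop-outcome pr py Q⇒⊁ (z ∷ rest) (unite G x z ld) f)
    pop : popLoop G pr py (x ∷ z ∷ rest) ld ≡ popLoop G pr py (z ∷ rest) (unite G x z ld)
    pop = popLoop-pop pr py x z rest ld x≻y
    ld′ : Fin n → Fin n
    ld′ = proj₂ (popLoop G pr py (z ∷ rest) (unite G x z ld))
    at : ∀ w → proj₂ (popLoop G pr py (x ∷ z ∷ rest) ld) w ≡ ld′ w
    at w = cong (λ o → proj₂ o w) pop
    merged′ : ∀ w → ld w ∈ₗ x ∷ popped → ld′ w ≡ survivor
    merged′ w _ with ld w ≟ x
    merged′ w _ | yes lw≡x with head-++ popped survivor below split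
    ... | inj₁ z∈ = merged w (subst (_∈ₗ popped) (sym (unite-hit x z ld w lw≡x)) z∈)
    ... | inj₂ (popped≡[] , z≡survivor) =
      trans (unmerged w (subst (_ ∉ₗ_) (sym popped≡[]) λ ())) (trans (unite-hit x z ld w lw≡x) z≡survivor)
    merged′ w (here lw≡x) | no lw≢x = ⊥-elim (lw≢x lw≡x)
    merged′ w (there lw∈) | no lw≢x = merged w (subst (_∈ₗ popped) (sym (unite-miss x z ld w lw≢x)) lw∈)
    unmerged′ : ∀ w → ld w ∉ₗ x ∷ popped → ld′ w ≡ ld w
    unmerged′ w lw∉ = trans (unmerged w (λ u∈ → lw∉ (there (subst (_∈ₗ popped) unite≡ u∈)))) unite≡
      where
      unite≡ : unite G x z ld w ≡ ld w
      unite≡ = unite-miss x z ld w (λ lw≡x → lw∉ (here lw≡x))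

  inSet : State G → Fin n → Fin n → Bool
  inSet s v w = not (isUnv G (pre s w)) ∧ does (ldr s w ≟ v)

  inSet⇒ : ∀ s v w → inSet s v w ≡ true → visited G s w × ldr s w ≡ v
  inSet⇒ s v w with pre s w | ldr s w ≟ v
  ... | unv   | _        = λ ()
  ... | num _ | yes lw≡v = λ _ → (λ ()) , lw≡v
  ... | num _ | no _     = λ ()
  ... | inf   | yes lw≡v = λ _ → (λ ()) , lw≡v
  ... | inf   | no _     = λ ()

  ⇒inSet : ∀ s v w → visited G s w → ldr s w ≡ v → inSet s v w ≡ true
  ⇒inSet s v w w-visited lw≡v with pre s w | ldr s w ≟ v
  ... | unv   | _      = ⊥-elim (w-visited refl)
  ... | num _ | yes _   = refl
  ... | num _ | no lw≢v = ⊥-elim (lw≢v lw≡v)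
  ... | inf   | yes _   = refl
  ... | inf   | no lw≢v = ⊥-elim (lw≢v lw≡v)

  unvisited⇒¬inSet : ∀ s v w → pre s w ≡ unv → inSet s v w ≡ false
  unvisited⇒¬inSet s v w unvisited with inSet s v w in e
  ... | false = refl
  ... | true  = ⊥-elim (proj₁ (inSet⇒ s v w e) unvisited)

  inSet⇒∈setOf : ∀ s v w → inSet s v w ≡ true → w ∈ setOf G s v
  inSet⇒∈setOf s v w e = lookup⇒[]= w (setOf G s v) (trans (lookup∘tabulate (inSet s v) w) e)

  ∈setOf⇒inSet : ∀ s v w → w ∈ setOf G s v → inSet s v w ≡ true
  ∈setOf⇒inSet s v w w∈ = trans (sym (lookup∘tabulate (inSet s v) w)) ([]=⇒lookup w∈)

  declare : State G → Fin n → List (Fin n) → State G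
  declare s v rest = record s
    { L   = rest
    ; pre = λ w → if inSet s v w then inf else pre s w
    ; out = setOf G s v ∷ out s }

  postvisit-top : ∀ s v rest → L s ≡ v ∷ rest → postvisit G v s ≡ declare s v rest
  postvisit-top s v rest e rewrite e | dec-true (v ≟ v) refl = refl

  postvisit-notTop : ∀ s v t rest → L s ≡ t ∷ rest → t ≢ v → postvisit G v s ≡ s
  postvisit-notTop s v t rest e t≢v rewrite e | dec-false (t ≟ v) t≢v = refl

  nonTree-popLoop : ∀ y s → nonTree G y s ≡
                    record s { L   = proj₁ (popLoop G (pre s) (pre s y) (L s) (ldr s))
                             ; ldr = proj₂ (popLoop G (pre s) (pre s y) (L s) (ldr s)) }
  nonTree-popLoop y s with popLoop G (pre s) (pre s y) (L s) (ldr s)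
  ... | _ = refl

  Finished : State G → Fin n → Set
  Finished s v = pre s v ≡ inf

  data TraversedArc (s : State G) (p : List (Fin m)) (a : Fin m) : Set where
    tail-finished : Finished s (tail a) → TraversedArc s p a
    tip-finished  : Finished s (tip a) → TraversedArc s p a
    same-set      : Numbered (pre s (tip a)) → ldr s (tail a) ≡ ldr s (tip a) → TraversedArc s p a
    on-path       : a ∈ₗ p → TraversedArc s p a

  LeaderOnStack : State G → Fin n → Set
  LeaderOnStack s y =
    First (λ x → pre s x ≻ pre s y) (λ x → x ≡ ldr s y × ¬ pre s x ≻ pre s y) (L s)

  record SearchInvariant (s : State G) (r : Fin n) (p : List (Fin m)) : Set where
    field
      tree-path       : IsTreePath r p
      increasing      : PreIncreasing (pre s) r p
      stack-on-path   : All (OnPath r p) (L s)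
      stack-sorted    : Sorted (pre s) (L s)
      stack-leaders   : All (λ x → ldr s x ≡ x) (L s)
      leader-on-stack : ∀ y → Numbered (pre s y) → LeaderOnStack s y
      leader-mutual   : ∀ y → Numbered (pre s y) → MutuallyReachable G y (ldr s y)
      untraversed     : ∀ a → trav s a ≡ false → pre s (tail a) ≡ unv ⊎ OnPath r p (tail a)
      traversed       : ∀ a → trav s a ≡ true → TraversedArc s p a

  leader-⊁ : ∀ {s r p} → SearchInvariant s r p → ∀ y → Numbered (pre s y) → ¬ pre s (ldr s y) ≻ pre s y
  leader-⊁ si y t with find (toAny (SearchInvariant.leader-on-stack si y t))
  ... | _ , _ , refl , l⊁y = l⊁y

  top-leader : ∀ {s r p} → SearchInvariant s r p → ∀ y {t rest} → L s ≡ t ∷ rest →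
               Numbered (pre s y) → ¬ pre s t ≻ pre s y → t ≡ ldr s y
  top-leader si y eL t t⊁y with subst (First _ _) eL (SearchInvariant.leader-on-stack si y t)
  ... | [ t≡l , _ ] = t≡l
  ... | t≻y ∷ _     = ⊥-elim (t⊁y t≻y)

  current-Numbered : ∀ {s r p} → SearchInvariant s r p → Numbered (pre s (current G (r , p)))
  current-Numbered {s} {r} {p} si =
    onPath-Numbered (pre s) r p (SearchInvariant.increasing si) _ (onPath-current r p)

  top-leads-current : ∀ {s r p} → SearchInvariant s r p → ∀ {t rest} → L s ≡ t ∷ rest →
                      t ≡ ldr s (current G (r , p))
  top-leads-current {s} {r} {p} si {t} eL =
    top-leader si (current G (r , p)) eL (current-Numbered si)
      (onPath-⊁-current (pre s) r p (SearchInvariant.increasing si) t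
         (All.lookup (SearchInvariant.stack-on-path si) (subst (t ∈ₗ_) (sym eL) (here refl))))

  current-visited : ∀ {s r p a} → SearchInvariant s r p → tail a ≡ current G (r , p) → visited G s (tail a)
  current-visited {s} si ta = Numbered⇒≢unv (subst (λ u → Numbered (pre s u)) (sym ta) (current-Numbered si))

  record IdleInvariant (s : State G) : Set where
    field
      stack-empty           : L s ≡ []
      visited-finished      : ∀ v → visited G s v → Finished s v
      untraversed-unvisited : ∀ a → trav s a ≡ false → pre s (tail a) ≡ unv

  PhaseInvariant : State G → Maybe (Fin n × List (Fin m)) → Set
  PhaseInvariant s nothing        = IdleInvariant s
  PhaseInvariant s (just (r , p)) = SearchInvariant s r p

  record GlobalInvariant (s : State G) : Set where
    field
      pre-below-next    : ∀ v k → pre s v ≡ num k → k < next s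
      traversed-visited : ∀ a → trav s a ≡ true → visited G s (tail a)
      finished-closed   : ∀ a → Finished s (tail a) → Finished s (tip a)
      finished-leader   : ∀ d → Finished s d → Finished s (ldr s d)
      finished-declared : ∀ d → Finished s d → ∃[ S ] (S ∈ₗ out s × d ∈ S)
      declared-strong   : ∀ S → S ∈ₗ out s → IsStrongComponent G S

  record Invariant (s : State G) : Set where
    field
      global : GlobalInvariant s
      phase  : PhaseInvariant s (search s)

  open Invariant
  open GlobalInvariant
  open SearchInvariant
  open IdleInvariant

  searchInvariant : ∀ {s r p} → Invariant s → search s ≡ just (r , p) → SearchInvariant s r p
  searchInvariant {s} inv sj = subst (PhaseInvariant s) sj (phase inv)

  terminal-declared⇔strong : ∀ s → Invariant s → Terminal G s →
                             ∀ S → (S ∈ₗ out s) ⇔ IsStrongComponent G S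
  terminal-declared⇔strong s inv (idle , allVisited) S = mk⇔ (declared-strong gl S) complete
    where
    gl : GlobalInvariant s
    gl = global inv
    idleInv : IdleInvariant s
    idleInv = subst (PhaseInvariant s) idle (phase inv)
    complete : IsStrongComponent G S → S ∈ₗ out s
    complete scc@(v , S≈) with finished-declared gl v (visited-finished idleInv v (allVisited v))
    ... | S′ , S′∈out , v∈S′ =
      subst (_∈ₗ out s) (strongComponent-unique v (declared-strong gl S′ S′∈out) scc v∈S′ v∈S) S′∈out
      where
      v∈S : v ∈ S
      v∈S = Equivalence.from (S≈ v) (ε , ε)

  initial-invariant : Invariant (initial G)
  initial-invariant = record
    { global = record
      { pre-below-next    = λ _ _ ()
      ; traversed-visited = λ _ ()
      ; finished-closed   = λ _ ()
      ; finished-leader   = λ _ ()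
      ; finished-declared = λ _ ()
      ; declared-strong   = λ _ () }
    ; phase = record
      { stack-empty           = refl
      ; visited-finished      = λ _ v-visited → ⊥-elim (v-visited refl)
      ; untraversed-unvisited = λ _ _ → refl } }

  global-setSearch : ∀ {s} sr → GlobalInvariant s → GlobalInvariant (setSearch G sr s)
  global-setSearch sr gl = record
    { pre-below-next = pre-below-next gl ; traversed-visited = traversed-visited gl
    ; finished-closed = finished-closed gl ; finished-leader = finished-leader gl
    ; finished-declared = finished-declared gl ; declared-strong = declared-strong gl }

  markArc-untraversed : ∀ s a b → trav (markArc G a s) b ≡ false → trav s b ≡ false
  markArc-untraversed s a b with b ≟ a
  ... | yes _ = λ ()
  ... | no _  = λ e → e

  markArc-traversed : ∀ s a b → trav (markArc G a s) b ≡ true → b ≡ a ⊎ trav s b ≡ true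
  markArc-traversed s a b with b ≟ a
  ... | yes b≡a = λ _ → inj₁ b≡a
  ... | no _    = inj₂

  markArc-global : ∀ s a → visited G s (tail a) → GlobalInvariant s → GlobalInvariant (markArc G a s)
  markArc-global s a tail-visited gl = record
    { pre-below-next = pre-below-next gl ; traversed-visited = tails-visited
    ; finished-closed = finished-closed gl ; finished-leader = finished-leader gl
    ; finished-declared = finished-declared gl ; declared-strong = declared-strong gl }
    where
    tails-visited : ∀ b → trav (markArc G a s) b ≡ true → visited G s (tail b)
    tails-visited b e with markArc-traversed s a b e
    ... | inj₁ refl = tail-visited
    ... | inj₂ e′   = traversed-visited gl b e′

  markArc-search : ∀ s r p a → SearchInvariant s r p → TraversedArc (markArc G a s) p a →
                   SearchInvariant (markArc G a s) r p
  markArc-search s r p a si a-ok = record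
    { tree-path = tree-path si ; increasing = increasing si ; stack-on-path = stack-on-path si
    ; stack-sorted = stack-sorted si ; stack-leaders = stack-leaders si
    ; leader-on-stack = leader-on-stack si ; leader-mutual = leader-mutual si
    ; untraversed = λ b e → untraversed si b (markArc-untraversed s a b e)
    ; traversed = ok }
    where
    ok : ∀ b → trav (markArc G a s) b ≡ true → TraversedArc (markArc G a s) p b
    ok b e with markArc-traversed s a b e
    ... | inj₁ refl = a-ok
    ... | inj₂ e′ with traversed si b e′
    ...   | tail-finished f = tail-finished f
    ...   | tip-finished f  = tip-finished f
    ...   | same-set t l    = same-set t l
    ...   | on-path b∈      = on-path b∈

  module Previsit (s : State G) (w : Fin n) (w-unvisited : pre s w ≡ unv) where
    s′ : State G
    s′ = previsit G w s

    pre-new : pre s′ w ≡ num (next s)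
    pre-new rewrite dec-true (w ≟ w) refl = refl

    pre-old : ∀ u → u ≢ w → pre s′ u ≡ pre s u
    pre-old u u≢w rewrite dec-false (u ≟ w) u≢w = refl

    ldr-new : ldr s′ w ≡ w
    ldr-new rewrite dec-true (w ≟ w) refl = refl

    ldr-old : ∀ u → u ≢ w → ldr s′ u ≡ ldr s u
    ldr-old u u≢w rewrite dec-false (u ≟ w) u≢w = refl

    visited⇒≢w : ∀ u → visited G s u → u ≢ w
    visited⇒≢w u u-visited refl = u-visited w-unvisited

    pre-visited : ∀ u → visited G s u → pre s′ u ≡ pre s u
    pre-visited u u-visited = pre-old u (visited⇒≢w u u-visited)

    pre-cases : ∀ u → (u ≡ w × pre s′ u ≡ num (next s)) ⊎ (u ≢ w × pre s′ u ≡ pre s u)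
    pre-cases u with u ≟ w
    ... | yes refl = inj₁ (refl , refl)
    ... | no u≢w   = inj₂ (u≢w , refl)

    finished-before : ∀ u → Finished s′ u → Finished s u
    finished-before u f with pre-cases u
    ... | inj₁ (_ , e) with trans (sym e) f
    ...   | ()
    finished-before u f | inj₂ (_ , e) = trans (sym e) f

    unvisited-before : ∀ u → pre s′ u ≡ unv → pre s u ≡ unv
    unvisited-before u uv with pre-cases u
    ... | inj₁ (_ , e) with trans (sym e) uv
    ...   | ()
    unvisited-before u uv | inj₂ (_ , e) = trans (sym e) uv

    numbered-cases : ∀ u → Numbered (pre s′ u) → u ≡ w ⊎ (u ≢ w × Numbered (pre s u))
    numbered-cases u t with pre-cases u
    ... | inj₁ (u≡w , _) = inj₁ u≡w
    ... | inj₂ (u≢w , e) = inj₂ (u≢w , subst Numbered e t)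

    new-≻ : GlobalInvariant s → ∀ u → Numbered (pre s u) → pre s′ w ≻ pre s′ u
    new-≻ gl u (k , e) =
      subst₂ _≻_ (sym pre-new) (sym (trans (pre-visited u (Numbered⇒≢unv (k , e))) e))
             (num≻num (pre-below-next gl u k e))

    finished-visited : ∀ {u} → Finished s u → visited G s u
    finished-visited f uv with trans (sym f) uv
    ... | ()

    previsit-global : GlobalInvariant s → GlobalInvariant s′
    previsit-global gl = record
      { pre-below-next    = below-next
      ; traversed-visited = λ a e uv → traversed-visited gl a e (unvisited-before (tail a) uv)
      ; finished-closed   = closed
      ; finished-leader   = leader
      ; finished-declared = λ d f → finished-declared gl d (finished-before d f)
      ; declared-strong   = declared-strong gl }
      where
      below-next : ∀ v k → pre s′ v ≡ num k → k < next s′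
      below-next v k e with pre-cases v
      ... | inj₁ (_ , e′) with trans (sym e′) e
      ...   | refl = n<1+n (next s)
      below-next v k e | inj₂ (_ , e′) = m<n⇒m<1+n (pre-below-next gl v k (trans (sym e′) e))
      closed : ∀ a → Finished s′ (tail a) → Finished s′ (tip a)
      closed a f = trans (pre-visited (tip a) (finished-visited tip-f)) tip-f
        where
        tip-f : Finished s (tip a)
        tip-f = finished-closed gl a (finished-before (tail a) f)
      leader : ∀ d → Finished s′ d → Finished s′ (ldr s′ d)
      leader d f = subst (Finished s′) (sym (ldr-old d (visited⇒≢w d (finished-visited d-f))))
                         (trans (pre-visited (ldr s d) (finished-visited ld-f)) ld-f)
        where
        d-f : Finished s d
        d-f = finished-before d f
        ld-f : Finished s (ldr s d)
        ld-f = finished-leader gl d d-f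

  newRoot-invariant : ∀ s v → Invariant s → search s ≡ nothing → pre s v ≡ unv →
                      Invariant (previsit G v (setSearch G (just (v , [])) s))
  newRoot-invariant s v inv idle v-unvisited =
    record { global = previsit-global (global-setSearch _ (global inv)) ; phase = search′ }
    where
    open Previsit (setSearch G (just (v , [])) s) v v-unvisited
    idleInv : IdleInvariant s
    idleInv = subst (PhaseInvariant s) idle (phase inv)
    only-v : ∀ y → Numbered (pre s′ y) → y ≡ v
    only-v y t with numbered-cases y t
    ... | inj₁ y≡v      = y≡v
    ... | inj₂ (_ , t′) = ⊥-elim (Numbered⇒≢inf t′ (visited-finished idleInv y (Numbered⇒≢unv t′)))
    on-empty : ∀ {P : Fin n → Set} → All P (L s)
    on-empty {P} = subst (All P) (sym (stack-empty idleInv)) []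
    leader : ∀ y → Numbered (pre s′ y) → LeaderOnStack s′ y
    leader y t with only-v y t
    ... | refl = [ sym ldr-new , ≻-irrefl ]
    mutual-reach : ∀ y → Numbered (pre s′ y) → MutuallyReachable G y (ldr s′ y)
    mutual-reach y t with only-v y t
    ... | refl = subst (MutuallyReachable G y) (sym ldr-new) (ε , ε)
    untraversed′ : ∀ a → trav s a ≡ false → pre s′ (tail a) ≡ unv ⊎ OnPath v [] (tail a)
    untraversed′ a e with pre-cases (tail a)
    ... | inj₁ (tail≡v , _) = inj₂ tail≡v
    ... | inj₂ (_ , e′)     = inj₁ (trans e′ (untraversed-unvisited idleInv a e))
    traversed′ : ∀ a → trav s a ≡ true → TraversedArc s′ [] a
    traversed′ a e = tail-finished (trans (pre-visited (tail a) tail-visited)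
                                          (visited-finished idleInv (tail a) tail-visited))
      where
      tail-visited : visited G s (tail a)
      tail-visited = traversed-visited (global inv) a e
    search′ : SearchInvariant s′ v []
    search′ = record
      { tree-path       = tt
      ; increasing      = next s , pre-new
      ; stack-on-path   = refl ∷ on-empty
      ; stack-sorted    = on-empty ∷ subst (Sorted (pre s′)) (sym (stack-empty idleInv)) []
      ; stack-leaders   = ldr-new ∷ on-empty
      ; leader-on-stack = leader
      ; leader-mutual   = mutual-reach
      ; untraversed     = untraversed′
      ; traversed       = traversed′ }

  treeArc-invariant : ∀ s r p a → Invariant s → search s ≡ just (r , p) → tail a ≡ current G (r , p) →
                      pre s (tip a) ≡ unv →
                      Invariant (previsit G (tip a) (setSearch G (just (r , a ∷ p)) (markArc G a s)))
  treeArc-invariant s r p a inv sj ta tip-unvisited =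
    record { global = previsit-global gl₁ ; phase = search′ }
    where
    open Previsit (setSearch G (just (r , a ∷ p)) (markArc G a s)) (tip a) tip-unvisited
    gl : GlobalInvariant s
    gl = global inv
    si : SearchInvariant s r p
    si = searchInvariant inv sj
    gl₁ : GlobalInvariant (setSearch G (just (r , a ∷ p)) (markArc G a s))
    gl₁ = global-setSearch _ (markArc-global s a (current-visited si ta) gl)
    path-Numbered : ∀ u → OnPath r p u → Numbered (pre s u)
    path-Numbered = onPath-Numbered (pre s) r p (increasing si)
    path≢tip : ∀ u → OnPath r p u → u ≢ tip a
    path≢tip u o = visited⇒≢w u (Numbered⇒≢unv (path-Numbered u o))
    stack-path : ∀ {x} → x ∈ₗ L s → OnPath r p x
    stack-path = All.lookup (stack-on-path si)
    stack≢tip : ∀ {x} → x ∈ₗ L s → x ≢ tip a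
    stack≢tip x∈ = path≢tip _ (stack-path x∈)
    leader : ∀ y → Numbered (pre s′ y) → LeaderOnStack s′ y
    leader y t with numbered-cases y t
    ... | inj₁ refl = [ sym ldr-new , ≻-irrefl ]
    ... | inj₂ (y≢tip , t′) =
      new-≻ gl₁ y t′ ∷
      First-mapUnder (All.tabulate stack≢tip)
        (λ x≢tip x≻y → subst₂ _≻_ (sym (pre-old _ x≢tip)) (sym (pre-old y y≢tip)) x≻y)
        (λ x≢tip (x≡l , x⊁y) → trans x≡l (sym (ldr-old y y≢tip)) ,
                               subst₂ (λ p q → ¬ p ≻ q) (sym (pre-old _ x≢tip)) (sym (pre-old y y≢tip)) x⊁y)
        (leader-on-stack si y t′)
    mutual-reach : ∀ y → Numbered (pre s′ y) → MutuallyReachable G y (ldr s′ y)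
    mutual-reach y t with numbered-cases y t
    ... | inj₁ refl        = subst (MutuallyReachable G y) (sym ldr-new) (ε , ε)
    ... | inj₂ (y≢tip , t′) = subst (MutuallyReachable G y) (sym (ldr-old y y≢tip)) (leader-mutual si y t′)
    untraversed′ : ∀ b → trav s′ b ≡ false → pre s′ (tail b) ≡ unv ⊎ OnPath r (a ∷ p) (tail b)
    untraversed′ b e with untraversed si b (markArc-untraversed s a b e)
    ... | inj₂ o = inj₂ (inj₂ o)
    ... | inj₁ uv with pre-cases (tail b)
    ...   | inj₁ (tail≡tip , _) = inj₂ (inj₁ tail≡tip)
    ...   | inj₂ (_ , e′)       = inj₁ (trans e′ uv)
    traversed′ : ∀ b → trav s′ b ≡ true → TraversedArc s′ (a ∷ p) b
    traversed′ b e with markArc-traversed s a b e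
    ... | inj₁ refl = on-path (here refl)
    ... | inj₂ e′ with traversed si b e′
    ...   | tail-finished f = tail-finished (trans (pre-visited (tail b) (finished-visited f)) f)
    ...   | tip-finished f  = tip-finished (trans (pre-visited (tip b) (finished-visited f)) f)
    ...   | same-set t l    =
      same-set (subst Numbered (sym (pre-visited (tip b) (Numbered⇒≢unv t))) t)
               (trans (ldr-old (tail b) (visited⇒≢w (tail b) (traversed-visited gl b e′)))
                      (trans l (sym (ldr-old (tip b) (visited⇒≢w (tip b) (Numbered⇒≢unv t))))))
    ...   | on-path b∈      = on-path (there b∈)
    search′ : SearchInvariant s′ r (a ∷ p)
    search′ = record
      { tree-path       = ta , tree-path si
      ; increasing      = (next s , pre-new) , (λ u o → new-≻ gl₁ u (path-Numbered u o)) ,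
                          preIncreasing-cong (pre s) (pre s′) r p (λ u o → pre-old u (path≢tip u o)) (increasing si)
      ; stack-on-path   = inj₁ refl ∷ All.tabulate (λ x∈ → inj₂ (stack-path x∈))
      ; stack-sorted    = All.tabulate (λ x∈ → new-≻ gl₁ _ (path-Numbered _ (stack-path x∈))) ∷
                          sorted-cong (pre s) (pre s′) (λ x∈ → pre-old _ (stack≢tip x∈)) (stack-sorted si)
      ; stack-leaders   = ldr-new ∷ All.tabulate (λ x∈ → trans (ldr-old _ (stack≢tip x∈)) (All.lookup (stack-leaders si) x∈))
      ; leader-on-stack = leader
      ; leader-mutual   = mutual-reach
      ; untraversed     = untraversed′
      ; traversed       = traversed′ }

  module NonTreeMerge (s : State G) (r : Fin n) (p : List (Fin m)) (a : Fin m) (inv : Invariant s)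
                      (sj : search s ≡ just (r , p)) (ta : tail a ≡ current G (r , p))
                      (tip-numbered : Numbered (pre s (tip a)))
                      (o : PopOutcome (pre s) (pre s (tip a))
                                      (λ x → x ≡ ldr s (tip a) × ¬ pre s x ≻ pre s (tip a))
                                      (L s) (ldr s)) where
    open PopOutcome o
    y c : Fin n
    y = tip a
    c = current G (r , p)
    gl : GlobalInvariant s
    gl = global inv
    si : SearchInvariant s r p
    si = searchInvariant inv sj
    ld′ : Fin n → Fin n
    ld′ = proj₂ (popLoop G (pre s) (pre s y) (L s) (ldr s))

    N : State G
    N = record (markArc G a s) { L = proj₁ (popLoop G (pre s) (pre s y) (L s) (ldr s)) ; ldr = ld′ }

    survivor≡ldr : survivor ≡ ldr s y
    survivor≡ldr = proj₁ survivor-Q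

    survivor-⊁ : ¬ pre s survivor ≻ pre s y
    survivor-⊁ = proj₂ survivor-Q

    ∈popped⇒∈L : ∀ {x} → x ∈ₗ popped → x ∈ₗ L s
    ∈popped⇒∈L x∈ = subst (_ ∈ₗ_) (sym split) (∈-++⁺ˡ x∈)

    ∈rest⇒∈L : ∀ {x} → x ∈ₗ survivor ∷ below → x ∈ₗ L s
    ∈rest⇒∈L x∈ = subst (_ ∈ₗ_) (sym split) (∈-++⁺ʳ popped x∈)

    stack-path : ∀ {x} → x ∈ₗ L s → OnPath r p x
    stack-path = All.lookup (stack-on-path si)

    popped-Numbered : ∀ {x} → x ∈ₗ popped → Numbered (pre s x)
    popped-Numbered x∈ = onPath-Numbered (pre s) r p (increasing si) _ (stack-path (∈popped⇒∈L x∈))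

    sorted-split : Sorted (pre s) (popped ++ survivor ∷ below)
    sorted-split = subst (Sorted (pre s)) split (stack-sorted si)

    ldr-rest : ∀ {x} → x ∈ₗ survivor ∷ below → ld′ x ≡ x
    ldr-rest {x} x∈ = trans (unmerged x (λ l∈ → sorted-disjoint (pre s) popped sorted-split (subst (_∈ₗ popped) lx≡x l∈) x∈)) lx≡x
      where
      lx≡x : ldr s x ≡ x
      lx≡x = All.lookup (stack-leaders si) (∈rest⇒∈L x∈)

    ldr-cong : ∀ u w → ldr s u ≡ ldr s w → ld′ u ≡ ld′ w
    ldr-cong u w eq with ldr s u ∈? popped
    ... | yes lu∈ = trans (merged u lu∈) (sym (merged w (subst (_∈ₗ popped) eq lu∈)))
    ... | no lu∉  = trans (unmerged u lu∉) (trans eq (sym (unmerged w (λ lw∈ → lu∉ (subst (_∈ₗ popped) (sym eq) lw∈)))))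

    ldr-tip : ld′ y ≡ survivor
    ldr-tip = trans (unmerged y (λ l∈ → ≻⇒popped l∈)) (sym survivor≡ldr)
      where ≻⇒popped : ldr s y ∉ₗ popped
            ≻⇒popped l∈ = survivor-⊁ (All.lookup popped-≻ (subst (_∈ₗ popped) (sym survivor≡ldr) l∈))

    ldr-current : ld′ c ≡ survivor
    ldr-current with popped | split | merged | unmerged
    ... | []    | split′ | _       | unmerged′ = trans (unmerged′ c (λ ())) (sym (top-leads-current si split′))
    ... | t ∷ _ | split′ | merged′ | _         = merged′ c (here (sym (top-leads-current si split′)))

    global′ : GlobalInvariant N
    global′ = record
      { pre-below-next = pre-below-next gl ; traversed-visited = traversed-visited gl₁
      ; finished-closed = finished-closed gl ; finished-leader = leader-finished
      ; finished-declared = finished-declared gl ; declared-strong = declared-strong gl }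
      where
      gl₁ : GlobalInvariant (markArc G a s)
      gl₁ = markArc-global s a (current-visited si ta) gl
      leader-finished : ∀ d → Finished s d → Finished s (ld′ d)
      leader-finished d f = subst (Finished s) (sym (unmerged d (λ l∈ → Numbered⇒≢inf (popped-Numbered l∈) lf))) lf
        where
        lf : Finished s (ldr s d)
        lf = finished-leader gl d f

    leader′ : ∀ y′ → Numbered (pre s y′) → LeaderOnStack N y′
    leader′ y′ t′ = subst (First _ _) (sym stack) (leader-rest (ldr s y′ ∈? popped))
      where
      leader-rest : Dec (ldr s y′ ∈ₗ popped) → First (λ x → pre s x ≻ pre s y′) (λ x → x ≡ ld′ y′ × ¬ pre s x ≻ pre s y′) (survivor ∷ below)
      leader-rest (yes l∈) = [ sym (merged y′ l∈) , survivor⊁y′ ]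
        where
        survivor⊁y′ : ¬ pre s survivor ≻ pre s y′
        survivor⊁y′ s≻y′ = survivor-⊁ (≻-trans (⊁-≻-≻ (popped-Numbered l∈) (leader-⊁ si y′ t′) s≻y′) (All.lookup popped-≻ l∈))
      leader-rest (no l∉) =
        First.map₂ (λ (x≡l , x⊁) → trans x≡l (sym (unmerged y′ l∉)) , x⊁)
          (First-++⁻ʳ popped (subst (First _ _) split (leader-on-stack si y′ t′)) (λ (x≡l , _) x∈ → l∉ (subst (_∈ₗ popped) x≡l x∈)))

    -- A popped leader lies on the path above the survivor, and the arc closes the cycle
    -- survivor ↝ popped leader ↝ current ⟶ tip ↝ survivor.
    mutual′ : ∀ y′ → Numbered (pre s y′) → MutuallyReachable G y′ (ld′ y′)
    mutual′ y′ t′ with ldr s y′ ∈? popped | leader-mutual si y′ t′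
    ... | no l∉  | reach = subst (MutuallyReachable G y′) (sym (unmerged y′ l∉)) reach
    ... | yes l∈ | y′↝x , x↝y′ = subst (MutuallyReachable G y′) (sym (merged y′ l∈)) (y′↝s , s↝y′)
      where
      x : Fin n
      x = ldr s y′
      x-path : OnPath r p x
      x-path = stack-path (∈popped⇒∈L l∈)
      y′↝s : Reachable G y′ survivor
      y′↝s = y′↝x ◅◅ onPath-reaches-current r p (tree-path si) x x-path ◅◅ (a , ta , refl) ◅
             subst (Reachable G y) (sym survivor≡ldr) (proj₁ (leader-mutual si y tip-numbered))
      s↝y′ : Reachable G survivor y′
      s↝y′ = onPath-⊁-reaches (pre s) r p (tree-path si) (increasing si) survivor x
               (stack-path (∈rest⇒∈L (here refl))) x-path
               (≻-⊁-⊁ (All.lookup popped-≻ l∈) survivor-⊁) ◅◅ x↝y′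

    traversed′ : ∀ b → trav N b ≡ true → TraversedArc N p b
    traversed′ b e with markArc-traversed s a b e
    ... | inj₁ refl = same-set tip-numbered (trans (cong ld′ ta) (trans ldr-current (sym ldr-tip)))
    ... | inj₂ e′ with traversed si b e′
    ...   | tail-finished f = tail-finished f
    ...   | tip-finished f  = tip-finished f
    ...   | same-set t l    = same-set t (ldr-cong (tail b) (tip b) l)
    ...   | on-path b∈      = on-path b∈

    search′ : SearchInvariant N r p
    search′ = record
      { tree-path       = tree-path si
      ; increasing      = increasing si
      ; stack-on-path   = subst (All (OnPath r p)) (sym stack) (++⁻ʳ popped (subst (All (OnPath r p)) split (stack-on-path si)))
      ; stack-sorted    = subst (Sorted (pre s)) (sym stack) (sorted-++⁻ʳ (pre s) popped sorted-split)
      ; stack-leaders   = subst (All (λ x → ld′ x ≡ x)) (sym stack) (All.tabulate ldr-rest)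
      ; leader-on-stack = leader′
      ; leader-mutual   = mutual′
      ; untraversed     = λ b e → untraversed si b (markArc-untraversed s a b e)
      ; traversed       = traversed′ }

    invariant : Invariant N
    invariant = record { global = global′ ; phase = subst (PhaseInvariant N) (sym sj) search′ }

  nonTreeArc-invariant : ∀ s r p a → Invariant s → search s ≡ just (r , p) → tail a ≡ current G (r , p) →
                         visited G s (tip a) → Invariant (nonTree G (tip a) (markArc G a s))
  nonTreeArc-invariant s r p a inv sj ta tip-visited with Pre-cases (pre s (tip a))
  ... | inj₁ uv = ⊥-elim (tip-visited uv)
  ... | inj₂ (inj₁ t) =
    subst Invariant (sym (nonTree-popLoop (tip a) (markArc G a s)))
      (NonTreeMerge.invariant s r p a inv sj ta t
        (popLoop-outcome (pre s) (pre s (tip a)) proj₂ (L s) (ldr s) (leader-on-stack si (tip a) t)))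
    where
    si : SearchInvariant s r p
    si = searchInvariant inv sj
  ... | inj₂ (inj₂ f) =
    subst Invariant (sym (trans (nonTree-popLoop (tip a) (markArc G a s))
                                (cong (λ res → record (markArc G a s) { L = proj₁ res ; ldr = proj₂ res })
                                      (popLoop-inert (pre s) (pre s (tip a)) (L s) (ldr s) (λ x → subst (λ q → ¬ pre s x ≻ q) (sym f) λ ())))))
      (record { global = markArc-global s a (current-visited si ta) (global inv)
              ; phase  = subst (PhaseInvariant (markArc G a s)) (sym sj) (markArc-search s r p a si (tip-finished f)) })
    where
    si : SearchInvariant s r p
    si = searchInvariant inv sj

  finished-reachable : ∀ {s u w} → GlobalInvariant s → Reachable G u w → Finished s u → Finished s w
  finished-reachable gl ε                        f = f
  finished-reachable gl ((a , refl , refl) ◅ as) f = finished-reachable gl as (finished-closed gl a f)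

  module Declare (s : State G) (inv : Invariant s) (r : Fin n) (p : List (Fin m))
                 (sj : search s ≡ just (r , p)) (rest : List (Fin n))
                 (eL : L s ≡ current G (r , p) ∷ rest)
                 (all-traversed : ∀ a → tail a ≡ current G (r , p) → trav s a ≡ true) where
    v : Fin n
    v = current G (r , p)
    gl : GlobalInvariant s
    gl = global inv
    si : SearchInvariant s r p
    si = searchInvariant inv sj

    v-Numbered : Numbered (pre s v)
    v-Numbered = current-Numbered si

    v-leader : ldr s v ≡ v
    v-leader = All.lookup (stack-leaders si) (subst (v ∈ₗ_) (sym eL) (here refl))

    v-inSet : inSet s v v ≡ true
    v-inSet = ⇒inSet s v v (Numbered⇒≢unv v-Numbered) v-leader

    inSet-Numbered : ∀ w → inSet s v w ≡ true → Numbered (pre s w)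
    inSet-Numbered w w∈ with Pre-cases (pre s w) | inSet⇒ s v w w∈
    ... | inj₁ uv         | w-visited , _ = ⊥-elim (w-visited uv)
    ... | inj₂ (inj₁ t)   | _           = t
    ... | inj₂ (inj₂ f)   | _ , lw≡v    =
      ⊥-elim (Numbered⇒≢inf v-Numbered (subst (Finished s) lw≡v (finished-leader gl w f)))

    inSet-⊁ : ∀ w → inSet s v w ≡ true → ¬ pre s v ≻ pre s w
    inSet-⊁ w w∈ = subst (λ l → ¬ pre s l ≻ pre s w) (proj₂ (inSet⇒ s v w w∈)) (leader-⊁ si w (inSet-Numbered w w∈))

    inSet-onPath⇒≡v : ∀ w → inSet s v w ≡ true → OnPath r p w → w ≡ v
    inSet-onPath⇒≡v w w∈ o with onPath-current⊎≺ (pre s) r p (increasing si) w o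
    ... | inj₁ w≡v = w≡v
    ... | inj₂ v≻w = ⊥-elim (inSet-⊁ w w∈ v≻w)

    -- Every arc out of v has been traversed, so neither an untraversed arc nor a tree arc
    -- leaves the set of v.
    arc-leaving-set : ∀ a → inSet s v (tail a) ≡ true → inSet s v (tip a) ≡ true ⊎ Finished s (tip a)
    arc-leaving-set a t∈ with trav s a in e
    ... | false with untraversed si a e
    ...   | inj₁ uv = ⊥-elim (proj₁ (inSet⇒ s v (tail a) t∈) uv)
    ...   | inj₂ o  with trans (sym e) (all-traversed a (inSet-onPath⇒≡v (tail a) t∈ o))
    ...     | ()
    arc-leaving-set a t∈ | true with traversed si a e
    ... | tail-finished f = ⊥-elim (Numbered⇒≢inf (inSet-Numbered (tail a) t∈) f)
    ... | tip-finished f  = inj₂ f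
    ... | same-set t l    = inj₁ (⇒inSet s v (tip a) (Numbered⇒≢unv t) (trans (sym l) (proj₂ (inSet⇒ s v (tail a) t∈))))
    ... | on-path a∈      = ⊥-elim (inSet-⊁ (tail a) t∈ (current-≻-tail (pre s) r p a (tree-path si) (increasing si) a∈))

    reachable-from-set : ∀ {u w} → Reachable G u w → inSet s v u ≡ true → inSet s v w ≡ true ⊎ Finished s w
    reachable-from-set ε                        u∈ = inj₁ u∈
    reachable-from-set ((a , refl , refl) ◅ as) u∈ with arc-leaving-set a u∈
    ... | inj₁ tip∈ = reachable-from-set as tip∈
    ... | inj₂ f    = inj₂ (finished-reachable gl as f)

    setOf-strong : IsStrongComponent G (setOf G s v)
    setOf-strong = v , λ w → mk⇔ (members w) (component w)
      where
      members : ∀ w → w ∈ setOf G s v → MutuallyReachable G v w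
      members w w∈ with ∈setOf⇒inSet s v w w∈
      ... | w∈′ with leader-mutual si w (inSet-Numbered w w∈′)
      ... | w↝l , l↝w = subst (λ l → MutuallyReachable G l w) (proj₂ (inSet⇒ s v w w∈′)) (l↝w , w↝l)
      component : ∀ w → MutuallyReachable G v w → w ∈ setOf G s v
      component w (v↝w , w↝v) with reachable-from-set v↝w v-inSet
      ... | inj₁ w∈ = inSet⇒∈setOf s v w w∈
      ... | inj₂ f  = ⊥-elim (Numbered⇒≢inf v-Numbered (finished-reachable gl w↝v f))

    D : State G
    D = declare s v rest

    declare-cases : ∀ w → (inSet s v w ≡ true × pre D w ≡ inf) ⊎ (inSet s v w ≡ false × pre D w ≡ pre s w)
    declare-cases w with inSet s v w
    ... | true  = inj₁ (refl , refl)
    ... | false = inj₂ (refl , refl)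

    pre-outside : ∀ w → inSet s v w ≡ false → pre D w ≡ pre s w
    pre-outside w w∉ rewrite w∉ = refl

    pre-inside : ∀ w → inSet s v w ≡ true → pre D w ≡ inf
    pre-inside w w∈ rewrite w∈ = refl

    finished-declare : ∀ w → Finished s w → Finished D w
    finished-declare w f with declare-cases w
    ... | inj₁ (_ , e) = e
    ... | inj₂ (_ , e) = trans e f

    unvisited-declare : ∀ w → pre s w ≡ unv → pre D w ≡ unv
    unvisited-declare w uv = trans (pre-outside w (unvisited⇒¬inSet s v w uv)) uv

    rest-⊀ : All (λ x → pre s v ≻ pre s x) rest
    rest-⊀ with subst (Sorted (pre s)) eL (stack-sorted si)
    ... | above ∷ _ = above

    rest-sorted : Sorted (pre s) rest
    rest-sorted with subst (Sorted (pre s)) eL (stack-sorted si)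
    ... | _ ∷ sorted = sorted

    rest≢v : ∀ {x} → x ∈ₗ rest → x ≢ v
    rest≢v x∈ refl = ≻-irrefl (All.lookup rest-⊀ x∈)

    rest-outside : ∀ {x} → x ∈ₗ rest → inSet s v x ≡ false
    rest-outside {x} x∈ with inSet s v x in e
    ... | false = refl
    ... | true  = ⊥-elim (rest≢v x∈ (trans (sym (All.lookup (stack-leaders si) (subst (x ∈ₗ_) (sym eL) (there x∈))))
                                             (proj₂ (inSet⇒ s v x e))))

    declare-global : ∀ sr → GlobalInvariant (setSearch G sr D)
    declare-global sr = record
      { pre-below-next    = λ w k e → pre-below-next gl w k (numbered-before w e)
      ; traversed-visited = λ a e uv → traversed-visited gl a e (unvisited-before (tail a) uv)
      ; finished-closed   = closed
      ; finished-leader   = leader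
      ; finished-declared = declared
      ; declared-strong   = λ { S (here refl) → setOf-strong ; S (there S∈) → declared-strong gl S S∈ } }
      where
      numbered-before : ∀ w {k} → pre D w ≡ num k → pre s w ≡ num k
      numbered-before w e with declare-cases w
      ... | inj₁ (_ , e′) with trans (sym e′) e
      ...   | ()
      numbered-before w e | inj₂ (_ , e′) = trans (sym e′) e
      unvisited-before : ∀ w → pre D w ≡ unv → pre s w ≡ unv
      unvisited-before w e with declare-cases w
      ... | inj₁ (_ , e′) with trans (sym e′) e
      ...   | ()
      unvisited-before w e | inj₂ (_ , e′) = trans (sym e′) e
      closed : ∀ a → Finished D (tail a) → Finished D (tip a)
      closed a f with declare-cases (tail a)
      ... | inj₂ (_ , e) = finished-declare (tip a) (finished-closed gl a (trans (sym e) f))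
      ... | inj₁ (t∈ , _) with arc-leaving-set a t∈
      ...   | inj₁ tip∈ = pre-inside (tip a) tip∈
      ...   | inj₂ f′   = finished-declare (tip a) f′
      leader : ∀ d → Finished D d → Finished D (ldr s d)
      leader d f with declare-cases d
      ... | inj₁ (d∈ , _) = subst (Finished D) (sym (proj₂ (inSet⇒ s v d d∈))) (pre-inside v v-inSet)
      ... | inj₂ (_ , e)  = finished-declare (ldr s d) (finished-leader gl d (trans (sym e) f))
      declared : ∀ d → Finished D d → ∃[ S ] (S ∈ₗ out D × d ∈ S)
      declared d f with declare-cases d
      ... | inj₁ (d∈ , _) = setOf G s v , here refl , inSet⇒∈setOf s v d d∈
      ... | inj₂ (_ , e) with finished-declared gl d (trans (sym e) f)
      ...   | S , S∈ , d∈S = S , there S∈ , d∈S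

  declare-root-invariant : ∀ s (inv : Invariant s) r (sj : search s ≡ just (r , [])) rest (eL : L s ≡ r ∷ rest)
                           (all-traversed : ∀ a → tail a ≡ r → trav s a ≡ true) →
                           Invariant (setSearch G nothing (declare s r rest))
  declare-root-invariant s inv r sj rest eL all-traversed = record { global = declare-global nothing ; phase = idle }
    where
    open Declare s inv r [] sj rest eL all-traversed
    ∉rest : ∀ {x} → x ∉ₗ rest
    ∉rest x∈ = rest≢v x∈ (All.lookup (stack-on-path si) (subst (_ ∈ₗ_) (sym eL) (there x∈)))
    -- With the stack reduced to the root, every numbered vertex is led by the root.
    visited-finished′ : ∀ w → visited G D w → Finished D w
    visited-finished′ w w-visited with declare-cases w
    ... | inj₁ (_ , e) = e
    ... | inj₂ (w∉ , e) with Pre-cases (pre s w)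
    ...   | inj₁ uv        = ⊥-elim (w-visited (trans e uv))
    ...   | inj₂ (inj₂ f)  = trans e f
    ...   | inj₂ (inj₁ t) with find (toAny (leader-on-stack si w t))
    ...     | x , x∈ , x≡l , _ with subst (x ∈ₗ_) eL x∈
    ...       | there x∈rest = ⊥-elim (∉rest x∈rest)
    ...       | here x≡r     with trans (sym w∉) (⇒inSet s v w (Numbered⇒≢unv t) (trans (sym x≡l) x≡r))
    ...         | ()
    idle : IdleInvariant (setSearch G nothing D)
    idle = record
      { stack-empty           = no-member⇒[] ∉rest
      ; visited-finished      = visited-finished′
      ; untraversed-unvisited = unvisited-tail }
      where
      unvisited-tail : ∀ a → trav s a ≡ false → pre D (tail a) ≡ unv
      unvisited-tail a e with untraversed si a e
      ... | inj₁ uv     = unvisited-declare (tail a) uv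
      ... | inj₂ tail≡r with trans (sym e) (all-traversed a tail≡r)
      ...   | ()

  declare-invariant : ∀ s (inv : Invariant s) r b p (sj : search s ≡ just (r , b ∷ p)) rest
                      (eL : L s ≡ tip b ∷ rest) (all-traversed : ∀ a → tail a ≡ tip b → trav s a ≡ true) →
                      Invariant (setSearch G (just (r , p)) (declare s (tip b) rest))
  declare-invariant s inv r b p sj rest eL all-traversed =
    record { global = declare-global (just (r , p)) ; phase = search′ }
    where
    open Declare s inv r (b ∷ p) sj rest eL all-traversed
    D′ : State G
    D′ = setSearch G (just (r , p)) D
    path-outside : ∀ u → OnPath r p u → inSet s v u ≡ false
    path-outside u o with inSet s v u in e
    ... | false = refl
    ... | true  = ⊥-elim (inSet-⊁ u e (proj₁ (proj₂ (increasing si)) u o))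
    rest-path : ∀ {x} → x ∈ₗ rest → OnPath r p x
    rest-path x∈ with All.lookup (stack-on-path si) (subst (_ ∈ₗ_) (sym eL) (there x∈))
    ... | inj₁ x≡v = ⊥-elim (rest≢v x∈ x≡v)
    ... | inj₂ o   = o
    numbered-outside : ∀ y → Numbered (pre D y) → inSet s v y ≡ false
    numbered-outside y t with declare-cases y
    ... | inj₁ (_ , e)  = ⊥-elim (Numbered⇒≢inf t e)
    ... | inj₂ (y∉ , _) = y∉
    numbered-before : ∀ y → Numbered (pre D y) → Numbered (pre s y)
    numbered-before y t = subst Numbered (pre-outside y (numbered-outside y t)) t
    leader′ : ∀ y → Numbered (pre D y) → LeaderOnStack D′ y
    leader′ y t with subst (First _ _) eL (leader-on-stack si y (numbered-before y t))
    ... | [ v≡l , _ ] with trans (sym (numbered-outside y t)) (⇒inSet s v y (Numbered⇒≢unv (numbered-before y t)) (sym v≡l))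
    ...   | ()
    leader′ y t | _ ∷ first =
      First-mapUnder (All.tabulate rest-outside)
        (λ x∉ x≻y → subst₂ _≻_ (sym (pre-outside _ x∉)) (sym (pre-outside y y∉)) x≻y)
        (λ x∉ (x≡l , x⊁y) → x≡l , subst₂ (λ p q → ¬ p ≻ q) (sym (pre-outside _ x∉)) (sym (pre-outside y y∉)) x⊁y)
        first
      where
      y∉ : inSet s v y ≡ false
      y∉ = numbered-outside y t
    untraversed′ : ∀ a → trav s a ≡ false → pre D (tail a) ≡ unv ⊎ OnPath r p (tail a)
    untraversed′ a e with untraversed si a e
    ... | inj₁ uv          = inj₁ (unvisited-declare (tail a) uv)
    ... | inj₂ (inj₂ o)    = inj₂ o
    ... | inj₂ (inj₁ tail≡v) with trans (sym e) (all-traversed a tail≡v)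
    ...   | ()
    traversed′ : ∀ a → trav s a ≡ true → TraversedArc D′ p a
    traversed′ a e with traversed si a e
    ... | tail-finished f  = tail-finished (finished-declare (tail a) f)
    ... | tip-finished f   = tip-finished (finished-declare (tip a) f)
    ... | on-path (here refl) = tip-finished (pre-inside v v-inSet)
    ... | on-path (there a∈)  = on-path a∈
    ... | same-set t l with declare-cases (tip a)
    ...   | inj₁ (_ , e′) = tip-finished e′
    ...   | inj₂ (_ , e′) = same-set (subst Numbered (sym e′) t) l
    search′ : SearchInvariant D′ r p
    search′ = record
      { tree-path       = proj₂ (tree-path si)
      ; increasing      = preIncreasing-cong (pre s) (pre D) r p (λ u o → pre-outside u (path-outside u o))
                                             (proj₂ (proj₂ (increasing si)))
      ; stack-on-path   = All.tabulate rest-path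
      ; stack-sorted    = sorted-cong (pre s) (pre D) (λ x∈ → pre-outside _ (rest-outside x∈)) rest-sorted
      ; stack-leaders   = ++⁻ʳ (v ∷ []) (subst (All (λ x → ldr s x ≡ x)) eL (stack-leaders si))
      ; leader-on-stack = leader′
      ; leader-mutual   = λ y t → leader-mutual si y (numbered-before y t)
      ; untraversed     = untraversed′
      ; traversed       = traversed′ }

  retreat-invariant : ∀ s (inv : Invariant s) r b p (sj : search s ≡ just (r , b ∷ p)) t rest (eL : L s ≡ t ∷ rest)
                      (t≢v : t ≢ tip b) (all-traversed : ∀ a → tail a ≡ tip b → trav s a ≡ true) →
                      Invariant (setSearch G (just (r , p)) s)
  retreat-invariant s inv r b p sj t rest eL t≢v all-traversed =
    record { global = global-setSearch (just (r , p)) (global inv) ; phase = search′ }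
    where
    si : SearchInvariant s r (b ∷ p)
    si = searchInvariant inv sj
    v u : Fin n
    v = tip b
    u = current G (r , p)
    t-leads-v : t ≡ ldr s v
    t-leads-v = top-leads-current si eL
    stack-path : ∀ {x} → x ∈ₗ L s → OnPath r p x
    stack-path {x} x∈ with All.lookup (stack-on-path si) x∈
    ... | inj₁ refl = ⊥-elim (t≢v (trans t-leads-v (All.lookup (stack-leaders si) x∈)))
    ... | inj₂ o    = o
    increasing′ : PreIncreasing (pre s) r p
    increasing′ = proj₂ (proj₂ (increasing si))
    t-leads-u : t ≡ ldr s u
    t-leads-u = top-leader si u eL (onPath-Numbered (pre s) r p increasing′ u (onPath-current r p))
                  (onPath-⊁-current (pre s) r p increasing′ t (stack-path (subst (t ∈ₗ_) (sym eL) (here refl))))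
    untraversed′ : ∀ a → trav s a ≡ false → pre s (tail a) ≡ unv ⊎ OnPath r p (tail a)
    untraversed′ a e with untraversed si a e
    ... | inj₁ uv            = inj₁ uv
    ... | inj₂ (inj₂ o)      = inj₂ o
    ... | inj₂ (inj₁ tail≡v) with trans (sym e) (all-traversed a tail≡v)
    ...   | ()
    traversed′ : ∀ a → trav s a ≡ true → TraversedArc (setSearch G (just (r , p)) s) p a
    traversed′ a e with traversed si a e
    ... | tail-finished f     = tail-finished f
    ... | tip-finished f      = tip-finished f
    ... | same-set t l        = same-set t l
    ... | on-path (there a∈)  = on-path a∈
    ... | on-path (here refl) =
      same-set (current-Numbered si) (trans (cong (ldr s) (proj₁ (tree-path si))) (trans (sym t-leads-u) t-leads-v))
    search′ : SearchInvariant (setSearch G (just (r , p)) s) r p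
    search′ = record
      { tree-path       = proj₂ (tree-path si)
      ; increasing      = increasing′
      ; stack-on-path   = All.tabulate stack-path
      ; stack-sorted    = stack-sorted si
      ; stack-leaders   = stack-leaders si
      ; leader-on-stack = leader-on-stack si
      ; leader-mutual   = leader-mutual si
      ; untraversed     = untraversed′
      ; traversed       = traversed′ }

  stack-nonempty : ∀ {s r p} → SearchInvariant s r p → ∃[ t ] ∃[ rest ] L s ≡ t ∷ rest
  stack-nonempty {s} si with L s | SearchInvariant.leader-on-stack si _ (current-Numbered si)
  ... | t ∷ rest | _ = t , rest , refl

  finish-invariant : ∀ s r p → Invariant s → search s ≡ just (r , p) →
                     (∀ a → tail a ≡ current G (r , p) → trav s a ≡ true) →
                     Invariant (setSearch G (retreat G (r , p)) (postvisit G (current G (r , p)) s))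
  finish-invariant s r [] inv sj all-traversed with stack-nonempty (searchInvariant inv sj)
  ... | t , rest , eL with t ≟ r
  ...   | yes refl = subst (λ s′ → Invariant (setSearch G nothing s′)) (sym (postvisit-top s t rest eL))
                       (declare-root-invariant s inv r sj rest eL all-traversed)
  ...   | no t≢r   = ⊥-elim (t≢r (All.lookup (stack-on-path (searchInvariant inv sj)) (subst (t ∈ₗ_) (sym eL) (here refl))))
  finish-invariant s r (b ∷ p) inv sj all-traversed with stack-nonempty (searchInvariant inv sj)
  ... | t , rest , eL with t ≟ tip b
  ...   | yes refl = subst (λ s′ → Invariant (setSearch G (just (r , p)) s′)) (sym (postvisit-top s t rest eL))
                       (declare-invariant s inv r b p sj rest eL all-traversed)
  ...   | no t≢v   = subst (λ s′ → Invariant (setSearch G (just (r , p)) s′)) (sym (postvisit-notTop s (tip b) t rest eL t≢v))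
                       (retreat-invariant s inv r b p sj t rest eL t≢v all-traversed)

  step-invariant : ∀ {s s′} → Invariant s → Step G s s′ → Invariant s′
  step-invariant {s} inv (newRoot v idle v-unvisited)       = newRoot-invariant s v inv idle v-unvisited
  step-invariant {s} inv (treeArc a sj ta _ tip-unvisited)  = treeArc-invariant s _ _ a inv sj ta tip-unvisited
  step-invariant {s} inv (nonTreeArc a sj ta _ tip-visited) = nonTreeArc-invariant s _ _ a inv sj ta tip-visited
  step-invariant {s} inv (finish sj all-traversed)          = finish-invariant s _ _ inv sj all-traversed

  reachable-invariant : ∀ {s} → Star (Step G) (initial G) s → Invariant s
  reachable-invariant = go initial-invariant
    where
    go : ∀ {s s′} → Invariant s → Star (Step G) s s′ → Invariant s′
    go inv ε          = inv
    go inv (st ◅ sts) = go (step-invariant inv st) sts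

theorem3 : (G : Digraph) (s : State G) →
           Star (Step G) (initial G) s → Terminal G s →
           ∀ (S : Subset (Digraph.n G)) →
             (S ∈ₗ out s) ⇔ IsStrongComponent G S
theorem3 G s run terminal = terminal-declared⇔strong G s (reachable-invariant G run) terminal
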